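{- Work in classical first-order logic with identity, in a language containing an individual constant $d$ and a constant $a_G$ denoting a totally arbitrary object, i.e. an arbitrary $G$ for the vacuous condition $G(x) :\equiv x = x$. Suppose the Principle of Generic Attribution (PGA) holds for $a_G$ with respect to every formula $\varphi(x)$ of the language (all formulas being treated as generic predicates), i.e. for every formula $\varphi(x)$ the sentence $\varphi(a_G) \leftrightarrow \forall i\,(G(i) \rightarrow \varphi(i))$ is assumed. Then $\forall x\, (x = d)$ is derivable in classical first-order logic from these assumptions.
   Context: The Principle of Generic Attribution (PGA): if $a_G$ is an arbitrary $G$, then for every generic predicate $\varphi$, $\varphi(a_G)$ holds if and only if $\forall i\,(G(i)\rightarrow \varphi(i))$. Implicit in PGA is a comprehension principle: for every non-empty predicate $G$ there exists at least one arbitrary $G$. A totally arbitrary object is an arbitrary $G$ for the vacuous condition $G(x):\equiv x=x$. -}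

module Defs where

open import Data.Nat using (ℕ; zero; suc)
open import Data.Fin using (Fin; zero; suc)
open import Data.Vec using (Vec; []; _∷_)
open import Data.List using (List; []; _∷_; map)
open import Data.List.Membership.Propositional using (_∈_)
open import Level using (Level; _⊔_) renaming (suc to lsuc)

record Language : Set₁ where
  field
    Const     : Set
    Func      : Set
    funArity  : Func → ℕ
    Pred      : Set
    predArity : Pred → ℕ
open Language public

module Syntax (L : Language) where

  -- terms with (at most) n free variables, de Bruijn indices
  data Term (n : ℕ) : Set where
    var : Fin n → Term n
    con : Const L → Term n
    app : (f : Func L) → Vec (Term n) (funArity L f) → Term n

  infixr 6 _⇒_
  infixr 7 _∧_
  infix  8 _≐_
  data Formula (n : ℕ) : Set where
    ⊥'   : Formula n
    _⇒_  : Formula n → Formula n → Formula n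
    _∧_  : Formula n → Formula n → Formula n
    ∀'   : Formula (suc n) → Formula n
    _≐_  : Term n → Term n → Formula n
    rel  : (r : Pred L) → Vec (Term n) (predArity L r) → Formula n

  Sentence : Set
  Sentence = Formula zero

  ¬' : ∀ {n} → Formula n → Formula n
  ¬' φ = φ ⇒ ⊥'

  infix 5 _⇔_
  _⇔_ : ∀ {n} → Formula n → Formula n → Formula n
  φ ⇔ ψ = (φ ⇒ ψ) ∧ (ψ ⇒ φ)

  liftR : ∀ {n m} → (Fin n → Fin m) → Fin (suc n) → Fin (suc m)
  liftR ρ zero    = zero
  liftR ρ (suc i) = suc (ρ i)

  mutual
    renT : ∀ {n m} → (Fin n → Fin m) → Term n → Term m
    renT ρ (var i)    = var (ρ i)
    renT ρ (con c)    = con c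
    renT ρ (app f ts) = app f (renTs ρ ts)

    renTs : ∀ {n m k} → (Fin n → Fin m) → Vec (Term n) k → Vec (Term m) k
    renTs ρ []       = []
    renTs ρ (t ∷ ts) = renT ρ t ∷ renTs ρ ts

  renF : ∀ {n m} → (Fin n → Fin m) → Formula n → Formula m
  renF ρ ⊥'        = ⊥'
  renF ρ (φ ⇒ ψ)   = renF ρ φ ⇒ renF ρ ψ
  renF ρ (φ ∧ ψ)   = renF ρ φ ∧ renF ρ ψ
  renF ρ (∀' φ)    = ∀' (renF (liftR ρ) φ)
  renF ρ (s ≐ t)   = renT ρ s ≐ renT ρ t
  renF ρ (rel r ts) = rel r (renTs ρ ts)

  liftS : ∀ {n m} → (Fin n → Term m) → Fin (suc n) → Term (suc m)
  liftS σ zero    = var zero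
  liftS σ (suc i) = renT suc (σ i)

  mutual
    subT : ∀ {n m} → (Fin n → Term m) → Term n → Term m
    subT σ (var i)    = σ i
    subT σ (con c)    = con c
    subT σ (app f ts) = app f (subTs σ ts)

    subTs : ∀ {n m k} → (Fin n → Term m) → Vec (Term n) k → Vec (Term m) k
    subTs σ []       = []
    subTs σ (t ∷ ts) = subT σ t ∷ subTs σ ts

  subF : ∀ {n m} → (Fin n → Term m) → Formula n → Formula m
  subF σ ⊥'         = ⊥'
  subF σ (φ ⇒ ψ)    = subF σ φ ⇒ subF σ ψ
  subF σ (φ ∧ ψ)    = subF σ φ ∧ subF σ ψ
  subF σ (∀' φ)     = ∀' (subF (liftS σ) φ)
  subF σ (s ≐ t)    = subT σ s ≐ subT σ t
  subF σ (rel r ts) = rel r (subTs σ ts)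

  single : ∀ {n} → Term n → Fin (suc n) → Term n
  single t zero    = t
  single t (suc i) = var i

  _[_] : ∀ {n} → Formula (suc n) → Term n → Formula n
  φ [ t ] = subF (single t) φ

  weakenS : ∀ {n} → Sentence → Formula n
  weakenS = renF (λ ())

  module Deduction {ℓ : Level} (T : Sentence → Set ℓ) where
    infix 3 _⊢_
    data _⊢_ {n : ℕ} (Γ : List (Formula n)) : Formula n → Set ℓ where
      hyp   : ∀ {φ} → φ ∈ Γ → Γ ⊢ φ
      ax    : ∀ {σ} → T σ → Γ ⊢ weakenS σ
      ⇒I    : ∀ {φ ψ} → (φ ∷ Γ) ⊢ ψ → Γ ⊢ φ ⇒ ψ
      ⇒E    : ∀ {φ ψ} → Γ ⊢ φ ⇒ ψ → Γ ⊢ φ → Γ ⊢ ψ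
      ∧I    : ∀ {φ ψ} → Γ ⊢ φ → Γ ⊢ ψ → Γ ⊢ φ ∧ ψ
      ∧E₁   : ∀ {φ ψ} → Γ ⊢ φ ∧ ψ → Γ ⊢ φ
      ∧E₂   : ∀ {φ ψ} → Γ ⊢ φ ∧ ψ → Γ ⊢ ψ
      raa   : ∀ {φ} → (¬' φ ∷ Γ) ⊢ ⊥' → Γ ⊢ φ
      ∀I    : ∀ {φ} → map (renF suc) Γ ⊢ φ → Γ ⊢ ∀' φ
      ∀E    : ∀ {φ} → Γ ⊢ ∀' φ → (t : Term n) → Γ ⊢ φ [ t ]
      ≐refl : ∀ {t} → Γ ⊢ t ≐ t
      ≐subst : ∀ {s t} (φ : Formula (suc n)) → Γ ⊢ s ≐ t → Γ ⊢ φ [ s ] → Γ ⊢ φ [ t ]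

    Derivable : Sentence → Set ℓ
    Derivable φ = [] ⊢ φ

  PGA-instance : Const L → Formula (suc zero) → Sentence
  PGA-instance a φ = φ [ con a ] ⇔ ∀' ((var zero ≐ var zero) ⇒ φ)

  -- the set of all PGA instances for a (every formula is generic)
  data PGA (a : Const L) : Sentence → Set where
    pga : (φ : Formula (suc zero)) → PGA a (PGA-instance a φ)

{-# OPTIONS --safe #-}
-- Apply PGA to φ(x) :≡ x = a.  Since a = a holds, PGA yields ∀i (i = i → i = a),
-- so every object is identical to a; in particular d = a, hence every x equals d.
module Submission where

open import Defs
open import Data.Nat using (zero)
open import Data.Fin using (Fin; zero; suc)
open import Data.Vec using (Vec; []; _∷_)
open import Data.List using (List)
open import Level using (Level)
open import Relation.Binary.PropositionalEquality using (_≡_; refl; cong; cong₂; sym; subst)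

module SubstitutionLemmas (L : Language) where
  open Syntax L

  mutual
    subT-renT-inverse : ∀ {n m} {ρ : Fin n → Fin m} {σ : Fin m → Term n} →
                        (∀ i → σ (ρ i) ≡ var i) → (t : Term n) → subT σ (renT ρ t) ≡ t
    subT-renT-inverse σρ≗var (var i)    = σρ≗var i
    subT-renT-inverse σρ≗var (con c)    = refl
    subT-renT-inverse σρ≗var (app f ts) = cong (app f) (subTs-renTs-inverse σρ≗var ts)

    subTs-renTs-inverse : ∀ {n m k} {ρ : Fin n → Fin m} {σ : Fin m → Term n} →
                          (∀ i → σ (ρ i) ≡ var i) → (ts : Vec (Term n) k) →
                          subTs σ (renTs ρ ts) ≡ ts
    subTs-renTs-inverse σρ≗var []       = refl
    subTs-renTs-inverse σρ≗var (t ∷ ts) =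
      cong₂ _∷_ (subT-renT-inverse σρ≗var t) (subTs-renTs-inverse σρ≗var ts)

  single-weaken : ∀ {n} (s t : Term n) → subT (single s) (renT suc t) ≡ t
  single-weaken s = subT-renT-inverse (λ _ → refl)

module Equality (L : Language) {ℓ : Level} (T : Syntax.Sentence L → Set ℓ) where
  open Syntax L
  open Deduction T
  open SubstitutionLemmas L

  module _ {n} {Γ : List (Formula n)} where

    ≐-euclidean : ∀ {s t u} → Γ ⊢ s ≐ t → Γ ⊢ s ≐ u → Γ ⊢ t ≐ u
    ≐-euclidean {s} {t} {u} s≐t s≐u =
      subst (λ v → Γ ⊢ t ≐ v) (single-weaken t u)
        (≐subst (var zero ≐ renT suc u) s≐t
          (subst (λ v → Γ ⊢ s ≐ v) (sym (single-weaken s u)) s≐u))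

    ≐-sym : ∀ {s t} → Γ ⊢ s ≐ t → Γ ⊢ t ≐ s
    ≐-sym s≐t = ≐-euclidean s≐t ≐refl

    ≐-trans : ∀ {s t u} → Γ ⊢ s ≐ t → Γ ⊢ t ≐ u → Γ ⊢ s ≐ u
    ≐-trans s≐t t≐u = ≐-euclidean (≐-sym s≐t) t≐u

module TotallyArbitrary (L : Language) (a : Const L) where
  open Syntax L
  open Deduction (PGA a)

  ≐-totally-arbitrary : ∀ {n} {Γ : List (Formula n)} (t : Term n) → Γ ⊢ t ≐ con a
  ≐-totally-arbitrary {Γ = Γ} t = ⇒E (∀E every-i≐a t) ≐refl
    where
    every-i≐a : Γ ⊢ ∀' ((var zero ≐ var zero) ⇒ (var zero ≐ con a))
    every-i≐a = ⇒E (∧E₁ (ax (pga (var zero ≐ con a)))) ≐refl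

proposition1 : (L : Language) (d a : Const L) →
    Syntax.Deduction.Derivable L (Syntax.PGA L a)
      (Syntax.∀' {L} (Syntax._≐_ {L} (Syntax.var {L} zero) (Syntax.con {L} d)))
proposition1 L d a =
  ∀I (≐-trans (≐-totally-arbitrary (var zero)) (≐-sym (≐-totally-arbitrary (con d))))
  where
  open Syntax L
  open Deduction (PGA a)
  open Equality L (PGA a)
  open TotallyArbitrary L a
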